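{- Let $n$ be an integer greater than $1$. If $f\colon\mathbb{N}^2\to\mathbb{N}$ is a base-$n$ discrete space-filling curve, then $f$ is a base-$n$ perfect pairing function.
   Context: $\mathbb{N}$ denotes the non-negative integers. $S_N$ is the set of permutations (bijections) of $\{0,1,\ldots,N-1\}$; $\circ$ is composition, $\sigma^k$ is the $k$-fold composite of $\sigma$ (identity for $k=0$), and $\sigma^{ -k}=(\sigma^{ -1})^k$. For $x\in\mathbb{N}$, $\operatorname{len}_n(x)=\lceil\log_n(x+1)\rceil$. A function $f\colon\mathbb{N}^2\to\mathbb{N}$ is a base-$n$ discrete space-filling curve if there exist permutations $\tau,\sigma_0,\sigma_1,\ldots,\sigma_{n^2-1}\in S_{n^2}$ such that: (a) $\tau(0)=0$ and $\sigma_0(0)=0$; (b) $f(0,0)=0$; (c) for all $x,y,z\in\mathbb{N}$ with $(x,y)\ne(0,0)$, $f(x,y)=z$ if and only if, writing $m=\max(\operatorname{len}_n(x),\operatorname{len}_n(y))$, $x=\sum_{i=0}^{m-1}x_in^i$ and $y=\sum_{i=0}^{m-1}y_in^i$ (base-$n$ digits $x_i,y_i\in\{0,\ldots,n-1\}$), and $z=\sum_{i=0}^{m-1}z_i(n^2)^i$ with $z_i\in\{0,\ldots,n^2-1\}$ (a base-$n^2$ expansion of $z$ with $m$ digits), one has $z_{m-1}=\sigma_0^{ -(m-1)}\circ\tau(nx_{m-1}+y_{m-1})$ and, for each $j=m-2,m-3,\ldots,0$, $z_j=\sigma_{z_{j+1}}\circ\sigma_{z_{j+2}}\circ\cdots\circ\sigma_{z_{m-1}}\circ\sigma_0^{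 -(m-1)}\circ\tau(nx_j+y_j)$. A pairing function is a bijection $\mathbb{N}^2\to\mathbb{N}$; it is base-$n$ perfect if for all $x,y,k\in\mathbb{N}$ with $\operatorname{len}_n(x)\le k$ and $\operatorname{len}_n(y)\le k$ one has $\operatorname{len}_n(f(x,y))\le 2k$. -}

module Defs where

open import Data.Nat using (ℕ; zero; suc; _+_; _*_; _∸_; _^_; _≤_; _<_; _<?_; NonZero; _⊔_; z<s; s<s)
open import Data.Nat.Properties using (m*n≢0; m^n≢0)
open import Data.Nat.DivMod using (_/_; _%_; _mod_)
open import Data.Fin using (Fin; fromℕ<)
open import Data.Fin.Permutation using (Permutation′; _⟨$⟩ʳ_; id; flip; _∘ₚ_)
open import Data.Product using (Σ; _×_; _,_)
open import Function.Definitions using (Bijective)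
open import Function.Bundles using (_⇔_)
open import Relation.Binary.PropositionalEquality using (_≡_)
open import Relation.Nullary.Decidable using (does)
open import Data.Bool using (if_then_else_)

uncurry₂ : (ℕ → ℕ → ℕ) → Σ ℕ (λ _ → ℕ) → ℕ
uncurry₂ f (x , y) = f x y

-- len_n(x) = ⌈ log_n (x+1) ⌉ = the least m with x + 1 ≤ n ^ m,
-- computed by a bounded search starting at m = 0 (the bound x + 1
-- is always sufficient when n ≥ 2, since x < 2 ^ (x+1) ≤ n ^ (x+1)).

lenSearch : (n x fuel m : ℕ) → ℕ
lenSearch n x zero      m = m
lenSearch n x (suc fuel) m =
  if does (x <? n ^ m) then m else lenSearch n x fuel (suc m)

len : (n x : ℕ) → ℕ
len n x = lenSearch n x (suc x) 0

digit : (n : ℕ) .{{_ : NonZero n}} → ℕ → ℕ → ℕ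
digit n x i = (x / n ^ i) % n
  where instance _ = m^n≢0 n i

module _ (n : ℕ) .{{nz : NonZero n}} where

  N : ℕ
  N = n * n

  instance
    N-nonZero : NonZero N
    N-nonZero = m*n≢0 n n

  zeroN : Fin N
  zeroN = 0 mod N

  digitN : ℕ → ℕ → Fin N
  digitN z i = (z / N ^ i) mod N
    where instance _ = m^n≢0 N i

  -- n * x_j + y_j, as an element of {0,…,n²-1}
  -- (this number is < n², so reduction mod n² does not change it)
  pairDigit : ℕ → ℕ → ℕ → Fin N
  pairDigit x y j = (n * digit n x j + digit n y j) mod N

  _^ₚ_ : Permutation′ N → ℕ → Permutation′ N
  σ ^ₚ zero  = id
  σ ^ₚ suc k = σ ∘ₚ (σ ^ₚ k)

  _^⁻_ : Permutation′ N → ℕ → Permutation′ N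
  σ ^⁻ k = flip σ ^ₚ k

  chain : (Fin N → Permutation′ N) → ℕ → ℕ → ℕ → Fin N → Fin N
  chain σ z j zero    v = v
  chain σ z j (suc k) v = σ (digitN z (suc j)) ⟨$⟩ʳ chain σ z (suc j) k v

  -- The digit condition of clause (c) for a given m:
  -- z has an m-digit base-n² expansion (z < (n²)^m), and for every
  -- j < m,  z_j = σ_{z_{j+1}} ∘ ⋯ ∘ σ_{z_{m-1}} ∘ σ_0^{-(m-1)} ∘ τ (n x_j + y_j)
  -- (for j = m-1 the chain of σ_{z_i} is empty).
  DigitCondition : (τ : Permutation′ N) (σ : Fin N → Permutation′ N)
                   (x y z : ℕ) → Set
  DigitCondition τ σ x y z =
    let m = len n x ⊔ len n y in
    (z < N ^ m) ×
    ((j : ℕ) → j < m →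
       digitN z j ≡
         chain σ z j (m ∸ suc j)
           ((σ zeroN ^⁻ (m ∸ 1)) ⟨$⟩ʳ (τ ⟨$⟩ʳ pairDigit x y j)))

  IsDiscreteSFC : (ℕ → ℕ → ℕ) → Set
  IsDiscreteSFC f =
    Σ (Permutation′ N) λ τ →
    Σ (Fin N → Permutation′ N) λ σ →
      (τ ⟨$⟩ʳ zeroN ≡ zeroN) ×
      (σ zeroN ⟨$⟩ʳ zeroN ≡ zeroN) ×
      (f 0 0 ≡ 0) ×
      ((x y z : ℕ) → ((x ≡ 0 × y ≡ 0) → Data.Empty.⊥) →
        ((f x y ≡ z) ⇔ DigitCondition τ σ x y z))
    where import Data.Empty

IsPairingFunction : (ℕ → ℕ → ℕ) → Set
IsPairingFunction f = Bijective _≡_ _≡_ (uncurry₂ f)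

IsPerfectPairing : ℕ → (ℕ → ℕ → ℕ) → Set
IsPerfectPairing n f =
  IsPairingFunction f ×
  ((x y k : ℕ) → len n x ≤ k → len n y ≤ k → len n (f x y) ≤ 2 * k)

module Submission where

-- Write width x y = max (len x) (len y) for the number m of digit positions used by
-- clause (c).  For each position j < m clause (c) says z_j = E_j (n x_j + y_j), where
-- the "encoder" E_j = chain ∘ σ₀^{-(m-1)} ∘ τ depends only on m and on the higher digits
-- of z, and is a permutation of {0,…,n²-1}.  Hence:
--   * z determines the paired digits n x_j + y_j = E_j⁻¹ (z_j), hence x and y, once m is known;
--   * at the top position E_{m-1} = σ₀^{-(m-1)} ∘ τ fixes 0, and the leading paired digit is
--     nonzero, so z_{m-1} ≠ 0: z has exactly m base-n² digits, so m is determined by z.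
-- This gives injectivity; surjectivity follows by reading the digits of any z ≠ 0 back
-- through the inverse encoders; and perfection because f x y < (n²)^m ≤ n^(2k).

open import Defs
open import Data.Bool using (true; false; T)
open import Data.Fin using (Fin; toℕ)
open import Data.Fin.Permutation using (Permutation′; _⟨$⟩ʳ_; _⟨$⟩ˡ_; inverseˡ; inverseʳ; id; _∘ₚ_)
open import Data.Fin.Properties using (toℕ-fromℕ<; toℕ-injective; toℕ<n)
open import Data.Empty using (⊥-elim)
open import Data.Nat
open import Data.Nat.DivMod
open import Data.Nat.Divisibility using (divides-refl)
open import Data.Nat.Properties
open import Data.Product using (Σ; _×_; _,_; proj₁; proj₂)
open import Data.Sum using (inj₁; inj₂)
open import Data.Unit using (tt)
open import Relation.Nullary using (¬_; Dec; contradiction; yes; no)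
open import Relation.Nullary.Decidable using (_×-dec_)
open import Function.Bundles using (_⇔_; Equivalence)
open import Relation.Binary.PropositionalEquality

module _ {b : ℕ} .{{_ : NonZero b}} {c : ℕ} (r : ℕ) (c<b : c < b) where

  [c+r*b]/b≡r : (c + r * b) / b ≡ r
  [c+r*b]/b≡r = begin
      (c + r * b) / b     ≡⟨ +-distrib-/-∣ʳ c (divides-refl r) ⟩
      c / b + r * b / b   ≡⟨ cong₂ _+_ (m<n⇒m/n≡0 c<b) (m*n/n≡m r b) ⟩
      r                   ∎
    where open ≡-Reasoning

  [c+r*b]%b≡c : (c + r * b) % b ≡ c
  [c+r*b]%b≡c = trans ([m+kn]%n≡m%n c r b) (m<n⇒m%n≡m c<b)

c+r*b<B*b : ∀ {b c B} r → c < b → r < B → c + r * b < B * b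
c+r*b<B*b {b} {c} {B} r c<b r<B = begin-strict
    c + r * b   <⟨ +-monoˡ-< (r * b) c<b ⟩
    b + r * b   ≡⟨⟩
    suc r * b   ≤⟨ *-monoˡ-≤ b r<B ⟩
    B * b       ∎
  where open ≤-Reasoning

module Positional (b : ℕ) .{{_ : NonZero b}} (1<b : 1 < b) where

  -- Powers peel off a factor b on the right, matching x = x % b + (x / b) * b.
  b^-suc : ∀ m → b ^ suc m ≡ b ^ m * b
  b^-suc m = *-comm b (b ^ m)

  -- x + 1 steps of the search defining len therefore always suffice.
  x<b^x : ∀ x → x < b ^ x
  x<b^x zero    = z<s
  x<b^x (suc x) = begin-strict
      suc x       ≤⟨ x<b^x x ⟩
      b ^ x       <⟨ m<m*n (b ^ x) b {{m^n≢0 b x}} 1<b ⟩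
      b ^ x * b   ≡⟨ sym (b^-suc x) ⟩
      b ^ suc x   ∎
    where open ≤-Reasoning

  IsLength : ℕ → ℕ → Set
  IsLength x r = x < b ^ r × (∀ i → i < r → b ^ i ≤ x)

  lenSearch-correct : ∀ x fuel m → (∀ i → i < m → b ^ i ≤ x) → x < b ^ (m + fuel) →
                      IsLength x (lenSearch b x fuel m)
  lenSearch-correct x zero m below above =
    subst (λ e → x < b ^ e) (+-identityʳ m) above , below
  lenSearch-correct x (suc fuel) m below above with x <ᵇ b ^ m in test
  ... | true  = <ᵇ⇒< x (b ^ m) (subst T (sym test) tt) , below
  ... | false = lenSearch-correct x fuel (suc m) below′
                  (subst (λ e → x < b ^ e) (+-suc m fuel) above)
    where
    below′ : ∀ i → i < suc m → b ^ i ≤ x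
    below′ i i<1+m with m≤n⇒m<n∨m≡n (s≤s⁻¹ i<1+m)
    ... | inj₁ i<m  = below i i<m
    ... | inj₂ refl = ≮⇒≥ (λ lt → subst T test (<⇒<ᵇ lt))

  len-correct : ∀ x → IsLength x (len b x)
  len-correct x = lenSearch-correct x (suc x) 0 (λ _ ()) (<-trans (x<b^x x) (^-monoʳ-< b 1<b (n<1+n x)))

  len-bound : ∀ x → x < b ^ len b x
  len-bound x = proj₁ (len-correct x)

  len-minimal : ∀ x i → i < len b x → b ^ i ≤ x
  len-minimal x = proj₂ (len-correct x)

  len-≤ : ∀ {x k} → x < b ^ k → len b x ≤ k
  len-≤ {x} {k} x<b^k = ≮⇒≥ (λ k<len → <⇒≱ x<b^k (len-minimal x k k<len))

  len-zero : len b 0 ≡ 0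
  len-zero = n≤0⇒n≡0 (len-≤ z<s)

  len≡0⇒≡0 : ∀ {x} → len b x ≡ 0 → x ≡ 0
  len≡0⇒≡0 {x} len≡0 = n<1⇒n≡0 (subst (λ r → x < b ^ r) len≡0 (len-bound x))

  0<b : 0 < b
  0<b = <-trans z<s 1<b

  digit-<b : ∀ x j → digit b x j < b
  digit-<b x j = m%n<n _ b

  digit-zero : ∀ x → digit b x 0 ≡ x % b
  digit-zero x = cong (_% b) (n/1≡n x)

  digit-suc : ∀ x j → digit b x (suc j) ≡ digit b (x / b) j
  digit-suc x j = cong (_% b) (sym (m/n/o≡m/[n*o] x b (b ^ j) {{_}} {{m^n≢0 b j}} {{m^n≢0 b (suc j)}}))

  digit-small : ∀ x j → x < b ^ j → digit b x j ≡ 0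
  digit-small x j x<b^j = begin
      (x / b ^ j) % b   ≡⟨ cong (_% b) (m<n⇒m/n≡0 x<b^j) ⟩
      0 % b             ≡⟨ m<n⇒m%n≡m 0<b ⟩
      0                 ∎
    where open ≡-Reasoning
          instance _ = m^n≢0 b j

  digits-ext : ∀ m {x x′} → x < b ^ m → x′ < b ^ m →
               (∀ j → j < m → digit b x j ≡ digit b x′ j) → x ≡ x′
  digits-ext zero    {x} {x′} x<1 x′<1 _ = trans (n<1⇒n≡0 x<1) (sym (n<1⇒n≡0 x′<1))
  digits-ext (suc m) {x} {x′} x<b^m x′<b^m same = begin
      x                     ≡⟨ m≡m%n+[m/n]*n x b ⟩
      x % b + x / b * b     ≡⟨ cong₂ (λ c r → c + r * b) last-same rest-same ⟩
      x′ % b + x′ / b * b   ≡⟨ m≡m%n+[m/n]*n x′ b ⟨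
      x′                    ∎
    where
    open ≡-Reasoning
    last-same : x % b ≡ x′ % b
    last-same = trans (sym (digit-zero x)) (trans (same 0 z<s) (digit-zero x′))
    rest-bound : ∀ {y} → y < b ^ suc m → y / b < b ^ m
    rest-bound {y} y<b^m = m<n*o⇒m/o<n (subst (y <_) (b^-suc m) y<b^m)
    rest-same : x / b ≡ x′ / b
    rest-same = digits-ext m (rest-bound x<b^m) (rest-bound x′<b^m) λ j j<m →
      trans (sym (digit-suc x j)) (trans (same (suc j) (s<s j<m)) (digit-suc x′ j))

  len-top : ∀ {x k} → len b x ≡ suc k → digit b x k ≢ 0
  len-top {x} {k} len≡ digit≡0 = contradiction lead≡0 (>⇒≢ (m≥n⇒m/n>0 (len-minimal x k k<len)))
    where
    instance _ = m^n≢0 b k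
    k<len : k < len b x
    k<len = subst (k <_) (sym len≡) (n<1+n k)
    lead<b : x / b ^ k < b
    lead<b = m<n*o⇒m/o<n (subst (λ r → x < b ^ r) len≡ (len-bound x))
    lead≡0 : x / b ^ k ≡ 0
    lead≡0 = trans (sym (m<n⇒m%n≡m lead<b)) digit≡0

  digit≢0⇒len : ∀ {x k} → digit b x k ≢ 0 → suc k ≤ len b x
  digit≢0⇒len {x} {k} digit≢0 = ≮⇒≥ λ len≤k →
    digit≢0 (digit-small x k (<-≤-trans (len-bound x) (^-monoʳ-≤ b (s≤s⁻¹ len≤k))))

  len-exact : ∀ {x k} → x < b ^ suc k → digit b x k ≢ 0 → len b x ≡ suc k
  len-exact x<b^k+1 digit≢0 = ≤-antisym (len-≤ x<b^k+1) (digit≢0⇒len digit≢0)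

  fromDigits : ℕ → (ℕ → ℕ) → ℕ
  fromDigits zero    d = 0
  fromDigits (suc m) d = d 0 + fromDigits m (λ j → d (suc j)) * b

  fromDigits-bound : ∀ m d → (∀ j → d j < b) → fromDigits m d < b ^ m
  fromDigits-bound zero    d d<b = z<s
  fromDigits-bound (suc m) d d<b = subst (fromDigits (suc m) d <_) (sym (b^-suc m))
    (c+r*b<B*b _ (d<b 0) (fromDigits-bound m (λ j → d (suc j)) (λ j → d<b (suc j))))

  fromDigits-digit : ∀ m d → (∀ j → d j < b) → ∀ j → j < m → digit b (fromDigits m d) j ≡ d j
  fromDigits-digit (suc m) d d<b zero    _ =
    trans (digit-zero _) ([c+r*b]%b≡c (fromDigits m (λ i → d (suc i))) (d<b 0))
  fromDigits-digit (suc m) d d<b (suc j) j<m = begin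
      digit b (fromDigits (suc m) d) (suc j)        ≡⟨ digit-suc _ j ⟩
      digit b (fromDigits (suc m) d / b) j          ≡⟨ cong (λ r → digit b r j) ([c+r*b]/b≡r _ (d<b 0)) ⟩
      digit b (fromDigits m (λ i → d (suc i))) j    ≡⟨ fromDigits-digit m _ (λ i → d<b (suc i)) j (s≤s⁻¹ j<m) ⟩
      d (suc j)                                     ∎
    where open ≡-Reasoning

module _ {m : ℕ} (π : Permutation′ m) where

  ⟨$⟩ʳ≡⇒≡⟨$⟩ˡ : ∀ {v w} → π ⟨$⟩ʳ v ≡ w → v ≡ π ⟨$⟩ˡ w
  ⟨$⟩ʳ≡⇒≡⟨$⟩ˡ {v} πv≡w = trans (sym (inverseˡ π)) (cong (π ⟨$⟩ˡ_) πv≡w)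

  ≡⟨$⟩ˡ⇒⟨$⟩ʳ≡ : ∀ {v w} → v ≡ π ⟨$⟩ˡ w → π ⟨$⟩ʳ v ≡ w
  ≡⟨$⟩ˡ⇒⟨$⟩ʳ≡ {v} v≡π⁻¹w = trans (cong (π ⟨$⟩ʳ_) v≡π⁻¹w) (inverseʳ π)

  module _ {a : Fin m} (fixes : π ⟨$⟩ʳ a ≡ a) where

    ⟨$⟩ˡ-fixed-point : π ⟨$⟩ˡ a ≡ a
    ⟨$⟩ˡ-fixed-point = sym (⟨$⟩ʳ≡⇒≡⟨$⟩ˡ fixes)

    ⟨$⟩ˡ≡fixed-point : ∀ {v} → π ⟨$⟩ˡ v ≡ a → v ≡ a
    ⟨$⟩ˡ≡fixed-point π⁻¹v≡a = trans (sym (≡⟨$⟩ˡ⇒⟨$⟩ʳ≡ (sym π⁻¹v≡a))) fixes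

module DigitPairs (n : ℕ) .{{_ : NonZero n}} (1<n : 1 < n) where

  instance
    N-nonZero′ : NonZero (N n)
    N-nonZero′ = N-nonZero n

  1<N : 1 < N n
  1<N = <-≤-trans 1<n (m≤m*n n n)

  open Positional n 1<n public
  module Base² = Positional (N n) 1<N

  toℕ-zeroN : toℕ (zeroN n) ≡ 0
  toℕ-zeroN = trans (toℕ-fromℕ< _) (m<n⇒m%n≡m (<-trans z<s 1<N))

  toℕ-digitN : ∀ z j → toℕ (digitN n z j) ≡ digit (N n) z j
  toℕ-digitN z j = toℕ-fromℕ< _

  digitN≡zeroN⇒digit≡0 : ∀ z j → digitN n z j ≡ zeroN n → digit (N n) z j ≡ 0
  digitN≡zeroN⇒digit≡0 z j e = trans (sym (toℕ-digitN z j)) (trans (cong toℕ e) toℕ-zeroN)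

  digit≡0⇒digitN≡zeroN : ∀ z j → digit (N n) z j ≡ 0 → digitN n z j ≡ zeroN n
  digit≡0⇒digitN≡zeroN z j e = toℕ-injective (trans (toℕ-digitN z j) (trans e (sym toℕ-zeroN)))

  hi lo : Fin (N n) → ℕ
  hi w = toℕ w / n
  lo w = toℕ w % n

  hi-<n : ∀ w → hi w < n
  hi-<n w = m<n*o⇒m/o<n (toℕ<n w)

  lo-<n : ∀ w → lo w < n
  lo-<n w = m%n<n (toℕ w) n

  toℕ-pairDigit : ∀ x y j → toℕ (pairDigit n x y j) ≡ digit n y j + digit n x j * n
  toℕ-pairDigit x y j = begin
      toℕ (pairDigit n x y j)         ≡⟨ toℕ-fromℕ< _ ⟩
      (n * dx + dy) % N n             ≡⟨ m<n⇒m%n≡m n*dx+dy<N ⟩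
      n * dx + dy                     ≡⟨ +-comm (n * dx) dy ⟩
      dy + n * dx                     ≡⟨ cong (dy +_) (*-comm n dx) ⟩
      dy + dx * n                     ∎
    where
    open ≡-Reasoning
    dx dy : ℕ
    dx = digit n x j
    dy = digit n y j
    n*dx+dy<N : n * dx + dy < N n
    n*dx+dy<N = subst₂ _<_ (trans (+-comm dy (dx * n)) (cong (_+ dy) (*-comm dx n))) (*-comm n n)
                  (c+r*b<B*b dx (digit-<b y j) (digit-<b x j))

  pairDigit-split : ∀ {x y j w} → pairDigit n x y j ≡ w → digit n x j ≡ hi w × digit n y j ≡ lo w
  pairDigit-split {x} {y} {j} refl =
      sym (trans (cong (_/ n) (toℕ-pairDigit x y j)) ([c+r*b]/b≡r _ (digit-<b y j)))
    , sym (trans (cong (_% n) (toℕ-pairDigit x y j)) ([c+r*b]%b≡c (digit n x j) (digit-<b y j)))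

  pairDigit-join : ∀ {x y j w} → digit n x j ≡ hi w → digit n y j ≡ lo w → pairDigit n x y j ≡ w
  pairDigit-join {x} {y} {j} {w} x≡hi y≡lo = toℕ-injective (begin
      toℕ (pairDigit n x y j)         ≡⟨ toℕ-pairDigit x y j ⟩
      digit n y j + digit n x j * n   ≡⟨ cong₂ (λ c r → c + r * n) y≡lo x≡hi ⟩
      lo w + hi w * n                 ≡⟨ m≡m%n+[m/n]*n (toℕ w) n ⟨
      toℕ w                           ∎)
    where open ≡-Reasoning

  hi-zeroN : hi (zeroN n) ≡ 0
  hi-zeroN = trans (cong (_/ n) toℕ-zeroN) (0/n≡0 n)

  lo-zeroN : lo (zeroN n) ≡ 0
  lo-zeroN = trans (cong (_% n) toℕ-zeroN) (m<n⇒m%n≡m 0<b)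

  width : ℕ → ℕ → ℕ
  width x y = len n x ⊔ len n y

  width-boundˡ : ∀ x y → x < n ^ width x y
  width-boundˡ x y = <-≤-trans (len-bound x) (^-monoʳ-≤ n (m≤m⊔n (len n x) (len n y)))

  width-boundʳ : ∀ x y → y < n ^ width x y
  width-boundʳ x y = <-≤-trans (len-bound y) (^-monoʳ-≤ n (m≤n⊔m (len n x) (len n y)))

  width-zero : width 0 0 ≡ 0
  width-zero = cong₂ _⊔_ len-zero len-zero

  width≡0⇒ : ∀ {x y} → width x y ≡ 0 → x ≡ 0 × y ≡ 0
  width≡0⇒ {x} {y} w≡0 =
      len≡0⇒≡0 (n≤0⇒n≡0 (subst (len n x ≤_) w≡0 (m≤m⊔n (len n x) (len n y))))
    , len≡0⇒≡0 (n≤0⇒n≡0 (subst (len n y ≤_) w≡0 (m≤n⊔m (len n x) (len n y))))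

  width≡suc⇒nonzero : ∀ {x y k} → width x y ≡ suc k → ¬ (x ≡ 0 × y ≡ 0)
  width≡suc⇒nonzero w≡ (refl , refl) = 0≢1+n (trans (sym width-zero) w≡)

  N^k≡n^[2k] : ∀ k → N n ^ k ≡ n ^ (2 * k)
  N^k≡n^[2k] k = trans (cong (λ b → (n * b) ^ k) (sym (*-identityʳ n))) (^-*-assoc n 2 k)

  width-top : ∀ {x y k} → width x y ≡ suc k → pairDigit n x y k ≢ zeroN n
  width-top {x} {y} {k} w≡ pair≡0 with ⊔-sel (len n x) (len n y)
  ... | inj₁ w≡lenx = len-top {x} (trans (sym w≡lenx) w≡) (trans (proj₁ (pairDigit-split {x} {y} {k} pair≡0)) hi-zeroN)
  ... | inj₂ w≡leny = len-top {y} (trans (sym w≡leny) w≡) (trans (proj₂ (pairDigit-split {x} {y} {k} pair≡0)) lo-zeroN)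

  width-exact : ∀ {x y k} → x < n ^ suc k → y < n ^ suc k → pairDigit n x y k ≢ zeroN n →
                width x y ≡ suc k
  width-exact {x} {y} {k} x< y< pair≢0 = ≤-antisym (⊔-lub (len-≤ x<) (len-≤ y<)) leading
    where
    leading : suc k ≤ width x y
    leading with digit n x k ≟ 0 | digit n y k ≟ 0
    ... | no  dx≢0 | _ = ≤-trans (digit≢0⇒len {x} dx≢0) (m≤m⊔n (len n x) (len n y))
    ... | yes _ | no  dy≢0 = ≤-trans (digit≢0⇒len {y} dy≢0) (m≤n⊔m (len n x) (len n y))
    ... | yes dx≡0 | yes dy≡0 =
      contradiction (pairDigit-join {x} {y} {k} (trans dx≡0 (sym hi-zeroN)) (trans dy≡0 (sym lo-zeroN))) pair≢0

module DigitRecursion (n : ℕ) .{{_ : NonZero n}} (1<n : 1 < n)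
  (τ : Permutation′ (N n)) (σ : Fin (N n) → Permutation′ (N n))
  (τ-fix : τ ⟨$⟩ʳ zeroN n ≡ zeroN n) (σ₀-fix : σ (zeroN n) ⟨$⟩ʳ zeroN n ≡ zeroN n) where

  open DigitPairs n 1<n public

  σ₀⁻ : ℕ → Permutation′ (N n)
  σ₀⁻ k = _^⁻_ n (σ (zeroN n)) k

  σ₀⁻-fix : ∀ k → σ₀⁻ k ⟨$⟩ʳ zeroN n ≡ zeroN n
  σ₀⁻-fix zero    = refl
  σ₀⁻-fix (suc k) = trans (cong (σ₀⁻ k ⟨$⟩ʳ_) (⟨$⟩ˡ-fixed-point (σ (zeroN n)) σ₀-fix)) (σ₀⁻-fix k)

  chainₚ : (z j k : ℕ) → Permutation′ (N n)
  chainₚ z j zero    = id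
  chainₚ z j (suc k) = chainₚ z (suc j) k ∘ₚ σ (digitN n z (suc j))

  chainₚ-apply : ∀ z j k v → chainₚ z j k ⟨$⟩ʳ v ≡ chain n σ z j k v
  chainₚ-apply z j zero    v = refl
  chainₚ-apply z j (suc k) v = cong (σ (digitN n z (suc j)) ⟨$⟩ʳ_) (chainₚ-apply z (suc j) k v)

  encoder : (z m j : ℕ) → Permutation′ (N n)
  encoder z m j = τ ∘ₚ σ₀⁻ (m ∸ 1) ∘ₚ chainₚ z j (m ∸ suc j)

  -- At the top position the chain is empty, so the encoder fixes 0.
  encoder-top : ∀ z k → encoder z (suc k) k ⟨$⟩ʳ zeroN n ≡ zeroN n
  encoder-top z k rewrite n∸n≡0 k = trans (cong (σ₀⁻ k ⟨$⟩ʳ_) τ-fix) (σ₀⁻-fix k)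

  -- Clause (c) for a given number m of positions; with m = width x y this is DigitCondition.
  Encodes : (x y z m : ℕ) → Set
  Encodes x y z m =
    (z < N n ^ m) ×
    ((j : ℕ) → j < m →
       digitN n z j ≡ chain n σ z j (m ∸ suc j) (σ₀⁻ (m ∸ 1) ⟨$⟩ʳ (τ ⟨$⟩ʳ pairDigit n x y j)))

  -- Since each encoder is invertible, clause (c) determines the paired digits from z.
  decode : (z m j : ℕ) → Fin (N n)
  decode z m j = encoder z m j ⟨$⟩ˡ digitN n z j

  encodes⇒decode : ∀ {x y z m} → Encodes x y z m → ∀ j → j < m → pairDigit n x y j ≡ decode z m j
  encodes⇒decode {x} {y} {z} {m} (_ , digits) j j<m = ⟨$⟩ʳ≡⇒≡⟨$⟩ˡ (encoder z m j)
    (trans (chainₚ-apply z j (m ∸ suc j) _) (sym (digits j j<m)))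

  decode⇒encodes : ∀ {x y z m} → z < N n ^ m → (∀ j → j < m → pairDigit n x y j ≡ decode z m j) →
                   Encodes x y z m
  decode⇒encodes {x} {y} {z} {m} z< decoded = z< , λ j j<m →
    trans (sym (≡⟨$⟩ˡ⇒⟨$⟩ʳ≡ (encoder z m j) (decoded j j<m))) (chainₚ-apply z j (m ∸ suc j) _)

  -- If (x , y) ≠ (0 , 0) is encoded by z on width x y positions, then z has exactly that many
  -- base-n² digits: the leading paired digit is nonzero and the top encoder fixes 0.
  encodes-len : ∀ {x y z} → ¬ (x ≡ 0 × y ≡ 0) → Encodes x y z (width x y) → len (N n) z ≡ width x y
  encodes-len {x} {y} {z} nonzero enc with width x y in w≡
  ... | zero  = ⊥-elim (nonzero (width≡0⇒ w≡))
  ... | suc k = Base².len-exact (proj₁ enc) λ z-digit≡0 →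
    width-top w≡ (trans (encodes⇒decode enc k (n<1+n k))
      (trans (cong (encoder z (suc k) k ⟨$⟩ˡ_) (digit≡0⇒digitN≡zeroN z k z-digit≡0))
        (⟨$⟩ˡ-fixed-point (encoder z (suc k) k) (encoder-top z k))))

  encodes-unique : ∀ {x y x′ y′ z m} → width x y ≡ m → width x′ y′ ≡ m →
                   Encodes x y z m → Encodes x′ y′ z m → x ≡ x′ × y ≡ y′
  encodes-unique {x} {y} {x′} {y′} {z} {m} refl w′≡ enc enc′ =
      digits-ext m (width-boundˡ x y) (subst (λ e → x′ < n ^ e) w′≡ (width-boundˡ x′ y′))
        (λ j j<m → trans (proj₁ (split j j<m)) (sym (proj₁ (split′ j j<m))))
    , digits-ext m (width-boundʳ x y) (subst (λ e → y′ < n ^ e) w′≡ (width-boundʳ x′ y′))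
        (λ j j<m → trans (proj₂ (split j j<m)) (sym (proj₂ (split′ j j<m))))
    where
    split : ∀ j → j < m → digit n x j ≡ hi (decode z m j) × digit n y j ≡ lo (decode z m j)
    split j j<m = pairDigit-split {x} {y} {j} (encodes⇒decode enc j j<m)
    split′ : ∀ j → j < m → digit n x′ j ≡ hi (decode z m j) × digit n y′ j ≡ lo (decode z m j)
    split′ j j<m = pairDigit-split {x′} {y′} {j} (encodes⇒decode enc′ j j<m)

  -- Conversely, every z with k + 1 base-n² digits encodes a pair of width k + 1: read the
  -- paired digits off with the inverse encoders and split each into two base-n digits.
  decoded-pair : ∀ {z k} → len (N n) z ≡ suc k →
                 Σ ℕ λ x → Σ ℕ λ y → width x y ≡ suc k × Encodes x y z (suc k)
  decoded-pair {z} {k} len≡ = x , y , width≡ , decode⇒encodes z<N^m pairs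
    where
    w : ℕ → Fin (N n)
    w = decode z (suc k)
    x y : ℕ
    x = fromDigits (suc k) (λ j → hi (w j))
    y = fromDigits (suc k) (λ j → lo (w j))
    z<N^m : z < N n ^ suc k
    z<N^m = subst (λ e → z < N n ^ e) len≡ (Base².len-bound z)
    pairs : ∀ j → j < suc k → pairDigit n x y j ≡ w j
    pairs j j<m = pairDigit-join {x} {y} {j}
      (fromDigits-digit (suc k) (λ i → hi (w i)) (λ i → hi-<n (w i)) j j<m)
      (fromDigits-digit (suc k) (λ i → lo (w i)) (λ i → lo-<n (w i)) j j<m)
    top≢0 : w k ≢ zeroN n
    top≢0 w≡0 = Base².len-top len≡ (digitN≡zeroN⇒digit≡0 z k
      (⟨$⟩ˡ≡fixed-point (encoder z (suc k) k) (encoder-top z k) w≡0))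
    width≡ : width x y ≡ suc k
    width≡ = width-exact
      (fromDigits-bound (suc k) (λ i → hi (w i)) (λ i → hi-<n (w i)))
      (fromDigits-bound (suc k) (λ i → lo (w i)) (λ i → lo-<n (w i)))
      (λ pair≡0 → top≢0 (trans (sym (pairs k (n<1+n k))) pair≡0))

module Curve (n : ℕ) .{{_ : NonZero n}} (1<n : 1 < n) (f : ℕ → ℕ → ℕ)
  (τ : Permutation′ (N n)) (σ : Fin (N n) → Permutation′ (N n))
  (τ-fix : τ ⟨$⟩ʳ zeroN n ≡ zeroN n) (σ₀-fix : σ (zeroN n) ⟨$⟩ʳ zeroN n ≡ zeroN n)
  (f-origin : f 0 0 ≡ 0)
  (f-digits : (x y z : ℕ) → ¬ (x ≡ 0 × y ≡ 0) → (f x y ≡ z) ⇔ DigitCondition n τ σ x y z) where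

  open DigitRecursion n 1<n τ σ τ-fix σ₀-fix

  encodes-value : ∀ {x y z} → ¬ (x ≡ 0 × y ≡ 0) → f x y ≡ z → Encodes x y z (width x y)
  encodes-value {x} {y} {z} nonzero = Equivalence.to (f-digits x y z nonzero)

  len-value : ∀ {x y} → ¬ (x ≡ 0 × y ≡ 0) → len (N n) (f x y) ≡ width x y
  len-value nonzero = encodes-len nonzero (encodes-value nonzero refl)

  value≢0 : ∀ {x y} → ¬ (x ≡ 0 × y ≡ 0) → f x y ≢ 0
  value≢0 nonzero f≡0 = nonzero (width≡0⇒ (trans (sym (len-value nonzero))
                                          (trans (cong (len (N n)) f≡0) Base².len-zero)))

  origin? : ∀ x y → Dec (x ≡ 0 × y ≡ 0)
  origin? x y = (x ≟ 0) ×-dec (y ≟ 0)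

  -- Two points off the origin with the same value have the same width (len-value), hence
  -- equal digits (encodes-unique); the origin is the only point with value 0.
  injective : ∀ x y x′ y′ → f x y ≡ f x′ y′ → x ≡ x′ × y ≡ y′
  injective x y x′ y′ f≡ with origin? x y | origin? x′ y′
  ... | yes (refl , refl) | yes (refl , refl) = refl , refl
  ... | yes (refl , refl) | no  nonzero′ = ⊥-elim (value≢0 nonzero′ (trans (sym f≡) f-origin))
  ... | no  nonzero       | yes (refl , refl) = ⊥-elim (value≢0 nonzero (trans f≡ f-origin))
  ... | no  nonzero       | no  nonzero′ =
    encodes-unique refl same-width (encodes-value nonzero refl)
      (subst (Encodes x′ y′ (f x y)) same-width (encodes-value nonzero′ (sym f≡)))
    where
    same-width : width x′ y′ ≡ width x y
    same-width = trans (sym (len-value nonzero′)) (trans (cong (len (N n)) (sym f≡)) (len-value nonzero))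

  surjective : ∀ z → Σ ℕ λ x → Σ ℕ λ y → f x y ≡ z
  surjective z with z ≟ 0 | len (N n) z in len≡
  ... | yes refl | _     = 0 , 0 , f-origin
  ... | no  z≢0  | zero  = ⊥-elim (z≢0 (Base².len≡0⇒≡0 len≡))
  ... | no  _    | suc k with decoded-pair len≡
  ... | x , y , width≡ , enc = x , y ,
    Equivalence.from (f-digits x y z (width≡suc⇒nonzero width≡)) (subst (Encodes x y z) (sym width≡) enc)

  perfect : ∀ x y k → len n x ≤ k → len n y ≤ k → len n (f x y) ≤ 2 * k
  perfect x y k lenx≤k leny≤k with origin? x y
  ... | yes (refl , refl) = ≤-trans (≤-reflexive (trans (cong (len n) f-origin) len-zero)) z≤n
  ... | no  nonzero = len-≤ (begin-strict
      f x y             <⟨ proj₁ (encodes-value nonzero refl) ⟩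
      N n ^ width x y   ≤⟨ ^-monoʳ-≤ (N n) (⊔-lub lenx≤k leny≤k) ⟩
      N n ^ k           ≡⟨ N^k≡n^[2k] k ⟩
      n ^ (2 * k)       ∎)
    where open ≤-Reasoning

theorem3p2 : (n : ℕ) .{{_ : NonZero n}} → 1 < n → (f : ℕ → ℕ → ℕ) →
    IsDiscreteSFC n f → IsPerfectPairing n f
theorem3p2 n 1<n f (τ , σ , τ-fix , σ₀-fix , f-origin , f-digits) =
  (pair-injective , pair-surjective) , perfect
  where
  open Curve n 1<n f τ σ τ-fix σ₀-fix f-origin f-digits
  pair-injective : ∀ {p q} → uncurry₂ f p ≡ uncurry₂ f q → p ≡ q
  pair-injective {x , y} {x′ , y′} f≡ with injective x y x′ y′ f≡
  ... | refl , refl = refl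
  pair-surjective : ∀ z → Σ (Σ ℕ (λ _ → ℕ)) λ p → ∀ {q} → q ≡ p → uncurry₂ f q ≡ z
  pair-surjective z with surjective z
  ... | x , y , f≡z = (x , y) , λ { refl → f≡z }
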